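{- Let $k\ge2$ be an integer. A series-parallel graph $G$ is $C_{2k+1}$-critical if and only if $G$ is isomorphic (as a graph) to a parallel sum $G_1\,\|\,G_2$ with $G_1\in\mathcal{F}_S^A$ and $G_2\in\mathcal{F}_T^B$ for some nonempty symmetric subsets $S,T,A,B$ of $\mathbb{Z}_{2k+1}$ such that $S\cap T=\emptyset$, $A\subseteq T$ and $B\subseteq S$.
   Context: We take $V(C_{2k+1})=\mathbb{Z}_{2k+1}$ with $u,v$ adjacent iff $u-v=\pm1$; a $C_{2k+1}$-colouring of $G$ is a map $\phi:V(G)\to\mathbb{Z}_{2k+1}$ with $\phi(u)-\phi(v)=\pm1$ for every edge $uv$. $G$ is $C_{2k+1}$-critical if it has no $C_{2k+1}$-colouring but every proper subgraph has one. A subset of $\mathbb{Z}_{2k+1}$ is symmetric if closed under multiplication by $-1$. A 2-terminal graph $(G,s,t)$ is a graph with two distinct distinguished vertices (terminals). The serial sum $(G_1,s_1,t_1)+(G_2,s_2,t_2)$ identifies $t_1$ with $s_2$, with terminals $s_1,t_2$; the parallel sum $(G_1,s_1,t_1)\,\|\,(G_2,s_2,t_2)$ identifies $s_1$ with $s_2$ (terminal $s$) and $t_1$ with $t_2$ (terminal $t$). $G$ is series-parallel if for some terminals $s,t$, $(G,s,t)$ can be built from single edges by serial and parallel sums. For nonempty $S\subseteq\mathbb{Z}_{2k+1}$, $(G,s,t)$ is $S$-forcing if $S=\{x:\exists$ a $C_{2k+1}$-colouring $\phi$ of $G$ with $\phi(s)=0,\phi(t)=x\}$, and minimally $S$-forcing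 if it is $S$-forcing and no proper subgraph $(G',s,t)$ is $S$-forcing. For disjoint nonempty symmetric $S,T\subseteq\mathbb{Z}_{2k+1}$, $\mathcal{F}_S^T$ is the family of minimally $S$-forcing 2-terminal series-parallel graphs $(G,s,t)$ such that for every edge $e\in E(G)$ there exist $x\in T$ and a $C_{2k+1}$-colouring $\phi$ of $G-e$ with $\phi(s)=0$ and $\phi(t)=x$. -}

module Defs where

open import Data.Nat using (ℕ; suc; _*_; _∸_; _%_)
open import Data.Nat.DivMod using (m%n<n)
open import Data.Bool using (Bool; true; false; T)
import Data.Bool
open import Data.Bool.Properties using (T-irrelevant)
open import Data.Unit using (⊤; tt)
open import Data.Empty using (⊥)
open import Data.Fin using (Fin; toℕ; fromℕ<)
import Data.Fin
open import Data.Fin.Subset using (Subset; _∈_)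
open import Data.Product using (Σ; _×_; _,_; ∃)
open import Data.Sum using (_⊎_; inj₁; inj₂)
import Data.Sum.Properties as SumP
import Data.Product.Properties as ProdP
open import Relation.Nullary using (¬_; Dec; yes; no)
open import Relation.Nullary.Decidable using (False; fromWitnessFalse)
open import Relation.Binary.PropositionalEquality using (_≡_; _≢_; refl; sym)
open import Relation.Binary.Definitions using (DecidableEquality)
open import Function.Bundles using (_↔_; Inverse; _⇔_)

Cyc : ℕ → Set
Cyc k = Fin (suc (2 * k))

Adj : (k : ℕ) → Cyc k → Cyc k → Set
Adj k u v = (suc (toℕ u) % suc (2 * k) ≡ toℕ v) ⊎ (suc (toℕ v) % suc (2 * k) ≡ toℕ u)

neg : (k : ℕ) → Cyc k → Cyc k
neg k x = fromℕ< (m%n<n (suc (2 * k) ∸ toℕ x) (suc (2 * k)))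

zeroC : (k : ℕ) → Cyc k
zeroC k = Data.Fin.zero

Symmetric : (k : ℕ) → Subset (suc (2 * k)) → Set
Symmetric k S = ∀ x → x ∈ S → neg k x ∈ S

-- (Multi)graphs: vertex type, edge type, and the two ends of each edge.
-- Edges are undirected; the order of src/tgt carries no meaning.

record Graph : Set₁ where
  field
    V   : Set
    E   : Set
    src : E → V
    tgt : E → V
open Graph public

IsColouring : (k : ℕ) (G : Graph) → (V G → Cyc k) → Set
IsColouring k G φ = ∀ e → Adj k (φ (src G e)) (φ (tgt G e))

Colourable : (k : ℕ) → Graph → Set
Colourable k G = Σ (V G → Cyc k) (IsColouring k G)

record Sub (G : Graph) : Set where
  field
    vs     : V G → Bool
    es     : E G → Bool
    closed : ∀ e → es e ≡ true → (vs (src G e) ≡ true) × (vs (tgt G e) ≡ true)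
open Sub public

Proper : {G : Graph} → Sub G → Set
Proper {G} H = (Σ (V G) λ v → vs H v ≡ false) ⊎ (Σ (E G) λ e → es H e ≡ false)

-- a colouring of the subgraph H (values on deleted vertices are irrelevant)
IsSubColouring : (k : ℕ) {G : Graph} (H : Sub G) → (V G → Cyc k) → Set
IsSubColouring k {G} H φ = ∀ e → es H e ≡ true → Adj k (φ (src G e)) (φ (tgt G e))

SubColourable : (k : ℕ) {G : Graph} → Sub G → Set
SubColourable k H = Σ _ (IsSubColouring k H)

Critical : (k : ℕ) → Graph → Set
Critical k G = ¬ Colourable k G × (∀ (H : Sub G) → Proper H → SubColourable k H)

record _≅_ (G G' : Graph) : Set where
  field
    vmap : V G ↔ V G'
    emap : E G ↔ E G'
    ends : ∀ e →
      ((Inverse.to vmap (src G e) ≡ src G' (Inverse.to emap e)) ×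
       (Inverse.to vmap (tgt G e) ≡ tgt G' (Inverse.to emap e)))
      ⊎
      ((Inverse.to vmap (src G e) ≡ tgt G' (Inverse.to emap e)) ×
       (Inverse.to vmap (tgt G e) ≡ src G' (Inverse.to emap e)))
open _≅_ public

-- 2-terminal graphs (vertex equality is required to be decidable, which
-- is needed to glue terminals; every finite graph has this property)

record TGraph : Set₁ where
  field
    graph : Graph
    s t   : V graph
    s≢t   : s ≢ t
    _≟_   : DecidableEquality (V graph)
open TGraph public

record _≅₂_ (H H' : TGraph) : Set where
  field
    iso  : graph H ≅ graph H'
    mapS : Inverse.to (vmap iso) (s H) ≡ s H'
    mapT : Inverse.to (vmap iso) (t H) ≡ t H'

private
  decFalse : ∀ {A : Set} {d : Dec A} → DecidableEquality (False d)
  decFalse p q = yes (T-irrelevant p q)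

  decFalse² : ∀ {A B : Set} {d : Dec A} {d' : Dec B} → DecidableEquality (False d × False d')
  decFalse² (p , p') (q , q') with T-irrelevant p q | T-irrelevant p' q'
  ... | refl | refl = yes refl

  inj₁-inj : ∀ {A B : Set} {x y : A} → inj₁ {B = B} x ≡ inj₁ y → x ≡ y
  inj₁-inj refl = refl

module _ (H₁ H₂ : TGraph) where
  private
    module H₁ = TGraph H₁
    module H₂ = TGraph H₂

  -- serial sum: t₁ identified with s₂; terminals s₁, t₂
  SerV : Set
  SerV = V H₁.graph ⊎ Σ (V H₂.graph) (λ v → False (H₂._≟_ v H₂.s))

  serEmb : V H₂.graph → SerV
  serEmb v with H₂._≟_ v H₂.s
  ... | yes _ = inj₁ H₁.t
  ... | no ne = inj₂ (v , fromWitnessFalse ne)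

  serGraph : Graph
  serGraph = record
    { V = SerV
    ; E = E H₁.graph ⊎ E H₂.graph
    ; src = λ { (inj₁ e) → inj₁ (src H₁.graph e) ; (inj₂ e) → serEmb (src H₂.graph e) }
    ; tgt = λ { (inj₁ e) → inj₁ (tgt H₁.graph e) ; (inj₂ e) → serEmb (tgt H₂.graph e) }
    }

  _+ₛ_ : TGraph
  _+ₛ_ = record
    { graph = serGraph
    ; s = inj₁ H₁.s
    ; t = inj₂ (H₂.t , fromWitnessFalse (λ eq → H₂.s≢t (sym eq)))
    ; s≢t = λ ()
    ; _≟_ = SumP.≡-dec H₁._≟_ (ProdP.≡-dec H₂._≟_ decFalse)
    }

  -- parallel sum: s₁ identified with s₂, t₁ identified with t₂
  ParV : Set
  ParV = V H₁.graph ⊎ Σ (V H₂.graph) (λ v → False (H₂._≟_ v H₂.s) × False (H₂._≟_ v H₂.t))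

  parEmb : V H₂.graph → ParV
  parEmb v with H₂._≟_ v H₂.s | H₂._≟_ v H₂.t
  ... | yes _ | _     = inj₁ H₁.s
  ... | no _  | yes _ = inj₁ H₁.t
  ... | no a  | no b  = inj₂ (v , fromWitnessFalse a , fromWitnessFalse b)

  parGraph : Graph
  parGraph = record
    { V = ParV
    ; E = E H₁.graph ⊎ E H₂.graph
    ; src = λ { (inj₁ e) → inj₁ (src H₁.graph e) ; (inj₂ e) → parEmb (src H₂.graph e) }
    ; tgt = λ { (inj₁ e) → inj₁ (tgt H₁.graph e) ; (inj₂ e) → parEmb (tgt H₂.graph e) }
    }

  _∥_ : TGraph
  _∥_ = record
    { graph = parGraph
    ; s = inj₁ H₁.s
    ; t = inj₁ H₁.t
    ; s≢t = λ eq → H₁.s≢t (inj₁-inj eq)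
    ; _≟_ = SumP.≡-dec H₁._≟_ (ProdP.≡-dec H₂._≟_ decFalse²)
    }

edgeT : TGraph
edgeT = record
  { graph = record { V = Bool ; E = ⊤ ; src = λ _ → false ; tgt = λ _ → true }
  ; s = false ; t = true ; s≢t = λ () ; _≟_ = Data.Bool._≟_ }

data SPTerm : Set where
  edge : SPTerm
  ser  : SPTerm → SPTerm → SPTerm
  par  : SPTerm → SPTerm → SPTerm

⟦_⟧ : SPTerm → TGraph
⟦ edge ⟧    = edgeT
⟦ ser a b ⟧ = ⟦ a ⟧ +ₛ ⟦ b ⟧
⟦ par a b ⟧ = ⟦ a ⟧ ∥ ⟦ b ⟧

SeriesParallel₂ : TGraph → Set
SeriesParallel₂ H = Σ SPTerm λ τ → H ≅₂ ⟦ τ ⟧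

SeriesParallel : Graph → Set
SeriesParallel G = Σ (V G) λ s → Σ (V G) λ t → Σ SPTerm λ τ →
  Σ (G ≅ graph ⟦ τ ⟧) λ i →
    (Inverse.to (vmap i) s ≡ TGraph.s ⟦ τ ⟧) × (Inverse.to (vmap i) t ≡ TGraph.t ⟦ τ ⟧)

Forcing : (k : ℕ) → Subset (suc (2 * k)) → TGraph → Set
Forcing k S H = ∀ x → x ∈ S ⇔
  (Σ (V (graph H) → Cyc k) λ φ → IsColouring k (graph H) φ × φ (s H) ≡ zeroC k × φ (t H) ≡ x)

SubForcing : (k : ℕ) → Subset (suc (2 * k)) → (H : TGraph) → Sub (graph H) → Set
SubForcing k S H H' = ∀ x → x ∈ S ⇔
  (Σ (V (graph H) → Cyc k) λ φ → IsSubColouring k H' φ × φ (s H) ≡ zeroC k × φ (t H) ≡ x)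

MinForcing : (k : ℕ) → Subset (suc (2 * k)) → TGraph → Set
MinForcing k S H = Forcing k S H ×
  (∀ (H' : Sub (graph H)) → vs H' (s H) ≡ true → vs H' (t H) ≡ true → Proper H' →
     ¬ SubForcing k S H H')

InF : (k : ℕ) → (S T : Subset (suc (2 * k))) → TGraph → Set
InF k S T H = SeriesParallel₂ H × MinForcing k S H ×
  (∀ (e : E (graph H)) → Σ (Cyc k) λ x → x ∈ T ×
     (Σ (V (graph H) → Cyc k) λ φ →
        (∀ e' → e' ≢ e → Adj k (φ (src (graph H) e')) (φ (tgt (graph H) e')))
        × φ (s H) ≡ zeroC k × φ (t H) ≡ x))

-- Rotations x ↦ x + d of C_{2k+1} act transitively, so colourings of a 2-terminal graph can
-- always be normalised to colour s with 0, and two colourings of the pieces of a serial sum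
-- can always be glued. Hence a single edge is colourable and a serial sum is never critical
-- (each piece is colourable once an edge of the other piece is deleted): a critical
-- series-parallel graph is a parallel sum X ∥ Y. Criticality of X ∥ Y then says that no
-- colourings of X and Y agree on (s, t), while deleting any edge of X (or Y) creates such a
-- pair. After normalisation this is: the forcing sets S of X and T of Y are disjoint, and for
-- every edge e, X − e reaches some colour of T at t; the latter makes X minimally S-forcing,
-- so X ∈ F_S^T and Y ∈ F_T^S. These sets are symmetric since negation is an automorphism of
-- the cycle fixing 0. Conversely the same conditions, read backwards, give uncolourability of
-- X ∥ Y and colourability of every edge deletion, which is criticality as there are no
-- isolated vertices.

module Submission where

open import Level using (Level; 0ℓ)
open import Data.Bool using (true; false; not)
open import Data.Bool.Properties using (T-irrelevant)
open import Data.Empty using (⊥; ⊥-elim)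
open import Data.Unit using (tt)
open import Data.Nat using (ℕ; zero; suc; _+_; _*_; _∸_; _%_; _/_; _≤_; _<?_)
import Data.Nat as ℕ
open import Data.Nat.Properties
  using (+-identityʳ; +-suc; +-assoc; +-comm; +-∸-assoc; m+[n∸m]≡n; m+n∸n≡m; <⇒≤; ≤-antisym; ≮⇒≥)
open import Data.Nat.DivMod
  using (m%n<n; m≡m%n+[m/n]*n; [m+kn]%n≡m%n; [m+n]%n≡m%n; m<n⇒m%n≡m; n%n≡0)
open import Data.Fin using (Fin; toℕ; fromℕ<)
open import Data.Fin.Properties using (toℕ-fromℕ<; toℕ-injective; toℕ<n; any?)
open import Data.Fin.Subset using (Subset; _⊆_; _∈_; _∉_; Nonempty; Empty; _∩_)
open import Data.Fin.Subset.Properties using (x∈p∩q⁺; x∈p∩q⁻)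
open import Data.Vec using (tabulate; lookup)
open import Data.Vec.Properties using (lookup∘tabulate; []=⇒lookup; lookup⇒[]=)
open import Data.Product using (Σ; _×_; _,_; proj₁)
open import Data.Sum using (_⊎_; inj₁; inj₂)
import Data.Sum as Sum
open import Data.Sum.Properties using (inj₁-injective; inj₂-injective) renaming (≡-dec to ⊎-≡-dec)
open import Function using (_∘_; id)
open import Function.Bundles using (Inverse; Injection; _⇔_; mk⇔; Equivalence)
open Equivalence using (to; from)
open import Function.Properties.Inverse using (↔⇒↣)
open import Function.Construct.Composition using (_⇔-∘_)
open import Function.Construct.Identity using (↔-id)
open import Function.Construct.Symmetry using (↔-sym; ⇔-sym)
open import Relation.Nullary using (¬_; Dec; yes; no; does; contradiction)
open import Relation.Nullary.Decidable using (False; toWitnessFalse; _⊎-dec_; _×-dec_; via-injection)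
import Relation.Nullary.Decidable as Dec
open import Relation.Unary using (Pred; Decidable; U)
open import Relation.Binary.Definitions using (DecidableEquality)
open import Relation.Binary.PropositionalEquality
  using (_≡_; _≢_; refl; sym; trans; cong; cong₂; subst; subst₂; module ≡-Reasoning)

open import Defs

module _ {ℓ : Level} {n : ℕ} {P : Pred (Fin n) ℓ} (P? : Decidable P) where

  subset : Subset n
  subset = tabulate (λ x → does (P? x))

  ∈-subset⇔ : ∀ x → x ∈ subset ⇔ P x
  ∈-subset⇔ x = mk⇔ member⇒P P⇒member
    where
    lookup-subset : lookup subset x ≡ does (P? x)
    lookup-subset = lookup∘tabulate (λ y → does (P? y)) x

    member⇒P : x ∈ subset → P x
    member⇒P x∈ with P? x | trans (sym lookup-subset) ([]=⇒lookup x∈)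
    ... | yes p | _ = p
    ... | no _  | ()

    P⇒member : P x → x ∈ subset
    P⇒member p with P? x | lookup⇒[]= x subset lookup-subset
    ... | yes _ | x∈ = x∈
    ... | no ¬p | _  = contradiction p ¬p

module CycleArithmetic (k : ℕ) where

  open ≡-Reasoning

  N : ℕ
  N = suc (2 * k)

  σ : Cyc k → Cyc k
  σ x = fromℕ< (m%n<n (suc (toℕ x)) N)

  toℕ-σ : ∀ x → toℕ (σ x) ≡ suc (toℕ x) % N
  toℕ-σ x = toℕ-fromℕ< (m%n<n (suc (toℕ x)) N)

  adj-σ : ∀ x → Adj k x (σ x)
  adj-σ x = inj₁ (sym (toℕ-σ x))

  σ-preserves-succ : ∀ {u v} → suc (toℕ u) % N ≡ toℕ v → suc (toℕ (σ u)) % N ≡ toℕ (σ v)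
  σ-preserves-succ {u} {v} eq rewrite toℕ-σ u | toℕ-σ v = cong (λ m → suc m % N) eq

  σ-adj : ∀ {u v} → Adj k u v → Adj k (σ u) (σ v)
  σ-adj = Sum.map σ-preserves-succ σ-preserves-succ

  rot : ℕ → Cyc k → Cyc k
  rot zero    x = x
  rot (suc d) x = σ (rot d x)

  rot-adj : ∀ d {u v} → Adj k u v → Adj k (rot d u) (rot d v)
  rot-adj zero    uv = uv
  rot-adj (suc d) uv = σ-adj (rot-adj d uv)

  [1+m%N]%N≡[1+m]%N : ∀ m → suc (m % N) % N ≡ suc m % N
  [1+m%N]%N≡[1+m]%N m = begin
    suc (m % N) % N                 ≡⟨ sym ([m+kn]%n≡m%n (suc (m % N)) (m / N) N) ⟩
    (suc (m % N) + (m / N) * N) % N ≡⟨ cong (λ z → suc z % N) (sym (m≡m%n+[m/n]*n m N)) ⟩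
    suc m % N                       ∎

  toℕ-rot : ∀ d x → toℕ (rot d x) ≡ (toℕ x + d) % N
  toℕ-rot zero x = begin
    toℕ x           ≡⟨ sym (m<n⇒m%n≡m (toℕ<n x)) ⟩
    toℕ x % N       ≡⟨ cong (_% N) (sym (+-identityʳ (toℕ x))) ⟩
    (toℕ x + 0) % N ∎
  toℕ-rot (suc d) x = begin
    toℕ (σ (rot d x))         ≡⟨ toℕ-σ (rot d x) ⟩
    suc (toℕ (rot d x)) % N   ≡⟨ cong (λ z → suc z % N) (toℕ-rot d x) ⟩
    suc ((toℕ x + d) % N) % N ≡⟨ [1+m%N]%N≡[1+m]%N (toℕ x + d) ⟩
    suc (toℕ x + d) % N       ≡⟨ cong (_% N) (sym (+-suc (toℕ x) d)) ⟩
    (toℕ x + suc d) % N       ∎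

  rot-reaches : ∀ a b → Σ ℕ λ d → rot d a ≡ b
  rot-reaches a b = (N ∸ toℕ a) + toℕ b , toℕ-injective (begin
    toℕ (rot ((N ∸ toℕ a) + toℕ b) a)   ≡⟨ toℕ-rot _ a ⟩
    (toℕ a + ((N ∸ toℕ a) + toℕ b)) % N ≡⟨ cong (_% N) (sym (+-assoc (toℕ a) _ _)) ⟩
    ((toℕ a + (N ∸ toℕ a)) + toℕ b) % N ≡⟨ cong (λ z → (z + toℕ b) % N) (m+[n∸m]≡n (<⇒≤ (toℕ<n a))) ⟩
    (N + toℕ b) % N                     ≡⟨ cong (_% N) (+-comm N (toℕ b)) ⟩
    (toℕ b + N) % N                     ≡⟨ [m+n]%n≡m%n (toℕ b) N ⟩
    toℕ b % N                           ≡⟨ m<n⇒m%n≡m (toℕ<n b) ⟩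
    toℕ b                               ∎)

  toℕ-neg : ∀ x → toℕ (neg k x) ≡ (N ∸ toℕ x) % N
  toℕ-neg x = toℕ-fromℕ< (m%n<n (N ∸ toℕ x) N)

  neg-zero : neg k (zeroC k) ≡ zeroC k
  neg-zero = toℕ-injective (trans (toℕ-neg (zeroC k)) (n%n≡0 N))

  neg-reverses-succ : ∀ {u v} → suc (toℕ u) % N ≡ toℕ v → suc (toℕ (neg k v)) % N ≡ toℕ (neg k u)
  neg-reverses-succ {u} {v} eq rewrite toℕ-neg u | toℕ-neg v | [1+m%N]%N≡[1+m]%N (N ∸ toℕ v)
    with suc (toℕ u) <? N
  ... | yes u+1<N rewrite m<n⇒m%n≡m u+1<N | sym eq =
    cong (_% N) (sym (+-∸-assoc 1 (<⇒≤ u+1<N)))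
  ... | no u+1≮N = begin
    suc (N ∸ toℕ v) % N ≡⟨ cong (λ z → suc (N ∸ z) % N) v≡0 ⟩
    suc N % N           ≡⟨ [m+n]%n≡m%n 1 N ⟩
    1 % N               ≡⟨ cong (_% N) (sym (m+n∸n≡m 1 (toℕ u))) ⟩
    (suc (toℕ u) ∸ toℕ u) % N ≡⟨ cong (λ z → (z ∸ toℕ u) % N) u+1≡N ⟩
    (N ∸ toℕ u) % N     ∎
    where
    u+1≡N : suc (toℕ u) ≡ N
    u+1≡N = ≤-antisym (toℕ<n u) (≮⇒≥ u+1≮N)
    v≡0 : toℕ v ≡ 0
    v≡0 = trans (sym eq) (trans (cong (_% N) u+1≡N) (n%n≡0 N))

  neg-adj : ∀ {u v} → Adj k u v → Adj k (neg k u) (neg k v)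
  neg-adj = Sum.swap ∘ Sum.map neg-reverses-succ neg-reverses-succ

Incident : (G : Graph) → V G → Set
Incident G v = Σ (E G) λ e → (src G e ≡ v) ⊎ (tgt G e ≡ v)

NoIsolated : Graph → Set
NoIsolated G = ∀ v → Incident G v

proper⇒missing-edge : {G : Graph} (H : Sub G) → NoIsolated G → Proper H →
                      Σ (E G) λ e → es H e ≡ false
proper⇒missing-edge H _  (inj₂ missing) = missing
proper⇒missing-edge H ni (inj₁ (v , v∉H)) with ni v
... | e , v∈e with es H e in e∈H
...   | false = e , e∈H
...   | true with v∈e | closed H e e∈H
...     | inj₁ refl | src∈H , _ = contradiction (trans (sym src∈H) v∉H) λ ()
...     | inj₂ refl | _ , tgt∈H = contradiction (trans (sym tgt∈H) v∉H) λ ()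

kept≢missing : ∀ {G} (H : Sub G) {e x} → es H e ≡ false → es H x ≡ true → x ≢ e
kept≢missing H e∉H x∈H refl = contradiction (trans (sym x∈H) e∉H) λ ()

module _ {G G' : Graph} (i : G ≅ G') where
  private
    module vmap = Inverse (vmap i)
    module emap = Inverse (emap i)

  ≅-sym : G' ≅ G
  ≅-sym = record { vmap = ↔-sym (vmap i) ; emap = ↔-sym (emap i) ; ends = ends-from }
    where
    from-end : ∀ {x} e' (end : E G' → V G') → vmap.to x ≡ end (emap.to (emap.from e')) →
               vmap.from (end e') ≡ x
    from-end {x} e' end p = begin
      vmap.from (end e')                         ≡⟨ cong (vmap.from ∘ end) (sym (emap.strictlyInverseˡ e')) ⟩
      vmap.from (end (emap.to (emap.from e')))   ≡⟨ cong vmap.from (sym p) ⟩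
      vmap.from (vmap.to x)                      ≡⟨ vmap.strictlyInverseʳ x ⟩
      x                                          ∎
      where open ≡-Reasoning

    ends-from : ∀ e' →
      ((vmap.from (src G' e') ≡ src G (emap.from e')) × (vmap.from (tgt G' e') ≡ tgt G (emap.from e')))
      ⊎ ((vmap.from (src G' e') ≡ tgt G (emap.from e')) × (vmap.from (tgt G' e') ≡ src G (emap.from e')))
    ends-from e' with ends i (emap.from e')
    ... | inj₁ (p , q) = inj₁ (from-end e' (src G') p , from-end e' (tgt G') q)
    ... | inj₂ (p , q) = inj₂ (from-end e' (src G') q , from-end e' (tgt G') p)

  incident-≅ : ∀ {v} → Incident G v → Incident G' (vmap.to v)
  incident-≅ (e , v∈e) with ends i e | v∈e
  ... | inj₁ (p , _) | inj₁ refl = emap.to e , inj₁ (sym p)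
  ... | inj₁ (_ , q) | inj₂ refl = emap.to e , inj₂ (sym q)
  ... | inj₂ (p , _) | inj₁ refl = emap.to e , inj₂ (sym p)
  ... | inj₂ (_ , q) | inj₂ refl = emap.to e , inj₁ (sym q)

  NoIsolated-≅ : NoIsolated G → NoIsolated G'
  NoIsolated-≅ ni v' = subst (Incident G') (vmap.strictlyInverseˡ v') (incident-≅ (ni (vmap.from v')))

≅₂-refl : (X : TGraph) → X ≅₂ X
≅₂-refl X = record
  { iso  = record { vmap = ↔-id _ ; emap = ↔-id _ ; ends = λ _ → inj₁ (refl , refl) }
  ; mapS = refl
  ; mapT = refl
  }

module _ (X Y : TGraph) where
  private
    module X = TGraph X
    module Y = TGraph Y

  parEmb-s : parEmb X Y Y.s ≡ inj₁ X.s
  parEmb-s with Y.s Y.≟ Y.s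
  ... | yes _    = refl
  ... | no s≢s = contradiction refl s≢s

  parEmb-t : parEmb X Y Y.t ≡ inj₁ X.t
  parEmb-t with Y.t Y.≟ Y.s | Y.t Y.≟ Y.t
  ... | yes t≡s | _       = contradiction (sym t≡s) Y.s≢t
  ... | no _    | yes _   = refl
  ... | no _    | no t≢t = contradiction refl t≢t

  parEmb-inj₁⇒terminal : ∀ {v x} → parEmb X Y v ≡ inj₁ x → (v ≡ Y.s) ⊎ (v ≡ Y.t)
  parEmb-inj₁⇒terminal {v} eq with v Y.≟ Y.s | v Y.≟ Y.t | eq
  ... | yes v≡s | _       | _ = inj₁ v≡s
  ... | no _    | yes v≡t | _ = inj₂ v≡t

  parEmb-inj₂⇒self : ∀ {v w} → parEmb X Y v ≡ inj₂ w → proj₁ w ≡ v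
  parEmb-inj₂⇒self {v} eq with v Y.≟ Y.s | v Y.≟ Y.t | eq
  ... | no _ | no _ | refl = refl

  parEmb-inner : ∀ v (v≢s : False (v Y.≟ Y.s)) (v≢t : False (v Y.≟ Y.t)) →
                 parEmb X Y v ≡ inj₂ (v , v≢s , v≢t)
  parEmb-inner v v≢s v≢t with parEmb X Y v in eq
  ... | inj₁ _ with parEmb-inj₁⇒terminal eq
  ...   | inj₁ v≡s = contradiction v≡s (toWitnessFalse v≢s)
  ...   | inj₂ v≡t = contradiction v≡t (toWitnessFalse v≢t)
  parEmb-inner v v≢s v≢t | inj₂ (v' , p , q) with parEmb-inj₂⇒self eq
  ... | refl = cong (λ w → inj₂ (v , w)) (cong₂ _,_ (T-irrelevant p v≢s) (T-irrelevant q v≢t))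

  serEmb-s : serEmb X Y Y.s ≡ inj₁ X.t
  serEmb-s with Y.s Y.≟ Y.s
  ... | yes _    = refl
  ... | no s≢s = contradiction refl s≢s

  serEmb-inj₁⇒s : ∀ {v x} → serEmb X Y v ≡ inj₁ x → v ≡ Y.s
  serEmb-inj₁⇒s {v} eq with v Y.≟ Y.s | eq
  ... | yes v≡s | _ = v≡s

  serEmb-inj₂⇒self : ∀ {v w} → serEmb X Y v ≡ inj₂ w → proj₁ w ≡ v
  serEmb-inj₂⇒self {v} eq with v Y.≟ Y.s | eq
  ... | no _ | refl = refl

  serEmb-inner : ∀ v (v≢s : False (v Y.≟ Y.s)) → serEmb X Y v ≡ inj₂ (v , v≢s)
  serEmb-inner v v≢s with serEmb X Y v in eq
  ... | inj₁ _ = contradiction (serEmb-inj₁⇒s eq) (toWitnessFalse v≢s)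
  ... | inj₂ (v' , p) with serEmb-inj₂⇒self eq
  ...   | refl = cong (λ w → inj₂ (v , w)) (T-irrelevant p v≢s)

  serEmb-t : serEmb X Y Y.t ≡ t (X +ₛ Y)
  serEmb-t = serEmb-inner Y.t _

  NoIsolated-∥ : NoIsolated (graph X) → NoIsolated (graph Y) → NoIsolated (graph (X ∥ Y))
  NoIsolated-∥ niX niY (inj₁ v) with niX v
  ... | e , inj₁ src≡v = inj₁ e , inj₁ (cong inj₁ src≡v)
  ... | e , inj₂ tgt≡v = inj₁ e , inj₂ (cong inj₁ tgt≡v)
  NoIsolated-∥ niX niY (inj₂ (v , v≢s , v≢t)) with niY v
  ... | e , inj₁ refl = inj₂ e , inj₁ (parEmb-inner v v≢s v≢t)
  ... | e , inj₂ refl = inj₂ e , inj₂ (parEmb-inner v v≢s v≢t)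

  NoIsolated-+ₛ : NoIsolated (graph X) → NoIsolated (graph Y) → NoIsolated (graph (X +ₛ Y))
  NoIsolated-+ₛ niX niY (inj₁ v) with niX v
  ... | e , inj₁ src≡v = inj₁ e , inj₁ (cong inj₁ src≡v)
  ... | e , inj₂ tgt≡v = inj₁ e , inj₂ (cong inj₁ tgt≡v)
  NoIsolated-+ₛ niX niY (inj₂ (v , v≢s)) with niY v
  ... | e , inj₁ refl = inj₂ e , inj₁ (serEmb-inner v v≢s)
  ... | e , inj₂ refl = inj₂ e , inj₂ (serEmb-inner v v≢s)

NoIsolated-⟦⟧ : ∀ τ → NoIsolated (graph ⟦ τ ⟧)
NoIsolated-⟦⟧ edge false = tt , inj₁ refl
NoIsolated-⟦⟧ edge true  = tt , inj₂ refl
NoIsolated-⟦⟧ (ser α β) = NoIsolated-+ₛ ⟦ α ⟧ ⟦ β ⟧ (NoIsolated-⟦⟧ α) (NoIsolated-⟦⟧ β)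
NoIsolated-⟦⟧ (par α β) = NoIsolated-∥ ⟦ α ⟧ ⟦ β ⟧ (NoIsolated-⟦⟧ α) (NoIsolated-⟦⟧ β)

SeriesParallel₂⇒NoIsolated : ∀ {X} → SeriesParallel₂ X → NoIsolated (graph X)
SeriesParallel₂⇒NoIsolated (τ , X≅τ) = NoIsolated-≅ (≅-sym (_≅₂_.iso X≅τ)) (NoIsolated-⟦⟧ τ)

some-edge : ∀ τ → E (graph ⟦ τ ⟧)
some-edge edge      = tt
some-edge (ser α _) = inj₁ (some-edge α)
some-edge (par α _) = inj₁ (some-edge α)

_≟ᴱ_ : ∀ {τ} → DecidableEquality (E (graph ⟦ τ ⟧))
_≟ᴱ_ {edge}    tt tt = yes refl
_≟ᴱ_ {ser α β} = ⊎-≡-dec (_≟ᴱ_ {α}) (_≟ᴱ_ {β})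
_≟ᴱ_ {par α β} = ⊎-≡-dec (_≟ᴱ_ {α}) (_≟ᴱ_ {β})

module Colourings (k : ℕ) where

  open CycleArithmetic k

  -- Colourings of the spanning subgraph with edge set P; G − e is P = (_≢ e).
  Colours : (G : Graph) → Pred (E G) 0ℓ → (V G → Cyc k) → Set
  Colours G P φ = ∀ e → P e → Adj k (φ (src G e)) (φ (tgt G e))

  ColourableOn : (G : Graph) → Pred (E G) 0ℓ → Set
  ColourableOn G P = Σ (V G → Cyc k) (Colours G P)

  Colours-weaken : ∀ {G P Q φ} → (∀ {e} → Q e → P e) → Colours G P φ → Colours G Q φ
  Colours-weaken Q⊆P c e q = c e (Q⊆P q)

  ColourableOn-weaken : ∀ {G P Q} → (∀ {e} → Q e → P e) → ColourableOn G P → ColourableOn G Q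
  ColourableOn-weaken {G} Q⊆P (φ , c) = φ , Colours-weaken {G} {φ = φ} Q⊆P c

  EdgeDeletionsColourable : Graph → Set
  EdgeDeletionsColourable G = ∀ e → ColourableOn G (_≢ e)

  EdgeCritical : Graph → Set
  EdgeCritical G = ¬ Colourable k G × EdgeDeletionsColourable G

  critical⇒EdgeDeletionsColourable : ∀ {G} → Critical k G → DecidableEquality (E G) →
                                     EdgeDeletionsColourable G
  critical⇒EdgeDeletionsColourable {G} (_ , subColourable) _≟ₑ_ e =
    ColourableOn-weaken kept-if-≢ (subColourable G-e (inj₂ (e , e-deleted)))
    where
    G-e : Sub G
    G-e = record { vs = λ _ → true ; es = λ x → not (does (x ≟ₑ e)) ; closed = λ _ _ → refl , refl }

    e-deleted : es G-e e ≡ false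
    e-deleted with e ≟ₑ e
    ... | yes _   = refl
    ... | no e≢e = contradiction refl e≢e

    kept-if-≢ : ∀ {x} → x ≢ e → es G-e x ≡ true
    kept-if-≢ {x} x≢e with x ≟ₑ e
    ... | yes x≡e = contradiction x≡e x≢e
    ... | no _    = refl

  EdgeDeletionsColourable⇒subColourable : ∀ {G} → NoIsolated G → EdgeDeletionsColourable G →
                                          ∀ (H : Sub G) → Proper H → SubColourable k H
  EdgeDeletionsColourable⇒subColourable ni deletionsColourable H proper
    with proper⇒missing-edge H ni proper
  ... | e , e∉H = ColourableOn-weaken (kept≢missing H e∉H) (deletionsColourable e)

  module _ {G G' : Graph} (i : G ≅ G') where
    private
      module vmap = Inverse (vmap i)
      module emap = Inverse (emap i)

    adj-pullback : (φ : V G' → Cyc k) → ∀ e →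
                   Adj k (φ (src G' (emap.to e))) (φ (tgt G' (emap.to e))) →
                   Adj k (φ (vmap.to (src G e))) (φ (vmap.to (tgt G e)))
    adj-pullback φ e adj with ends i e
    ... | inj₁ (p , q) rewrite p | q = adj
    ... | inj₂ (p , q) rewrite p | q = Sum.swap adj

    Colourable-pullback : Colourable k G' → Colourable k G
    Colourable-pullback (φ , c) = φ ∘ vmap.to , λ e → adj-pullback φ e (c (emap.to e))

    EdgeDeletionsColourable-pullback : EdgeDeletionsColourable G' → EdgeDeletionsColourable G
    EdgeDeletionsColourable-pullback deletionsColourable e with deletionsColourable (emap.to e)
    ... | φ , c = φ ∘ vmap.to , λ x x≢e → adj-pullback φ x (c (emap.to x) (x≢e ∘ emap-injective))
      where
      emap-injective : ∀ {x y} → emap.to x ≡ emap.to y → x ≡ y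
      emap-injective = Injection.injective (↔⇒↣ (emap i))

  TCol : (X : TGraph) → Pred (E (graph X)) 0ℓ → Cyc k → Cyc k → Set
  TCol X P a b = Σ (V (graph X) → Cyc k) λ φ → Colours (graph X) P φ × φ (s X) ≡ a × φ (t X) ≡ b

  TColourable : TGraph → Cyc k → Cyc k → Set
  TColourable X = TCol X U

  TColourable⇔ : ∀ {X a b} →
    (Σ (V (graph X) → Cyc k) λ φ → IsColouring k (graph X) φ × φ (s X) ≡ a × φ (t X) ≡ b) ⇔
    TColourable X a b
  TColourable⇔ = mk⇔ (λ (φ , c , φs , φt) → φ , (λ e _ → c e) , φs , φt)
                     (λ (φ , c , φs , φt) → φ , (λ e → c e _) , φs , φt)

  TColourable⇒Colourable : ∀ {X a b} → TColourable X a b → Colourable k (graph X)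
  TColourable⇒Colourable (φ , c , _) = φ , λ e → c e _

  Colourable⇒TColourable : ∀ {X} (c : Colourable k (graph X)) → TColourable X (proj₁ c (s X)) (proj₁ c (t X))
  Colourable⇒TColourable (φ , c) = φ , (λ e _ → c e) , refl , refl

  TCol-weaken : ∀ {X P Q a b} → (∀ {e} → Q e → P e) → TCol X P a b → TCol X Q a b
  TCol-weaken {X} Q⊆P (φ , c , φs , φt) = φ , Colours-weaken {graph X} {φ = φ} Q⊆P c , φs , φt

  TCol-map : ∀ {X P a b} (f : Cyc k → Cyc k) → (∀ {u v} → Adj k u v → Adj k (f u) (f v)) →
             TCol X P a b → TCol X P (f a) (f b)
  TCol-map f f-adj (φ , c , φs , φt) = f ∘ φ , (λ e p → f-adj (c e p)) , cong f φs , cong f φt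

  TCol-shift : ∀ {X P a b} → TCol X P a b → ∀ a' → Σ (Cyc k) λ b' → TCol X P a' b'
  TCol-shift {X} {P} {a} {b} c a' with rot-reaches a a'
  ... | d , refl = rot d b , TCol-map {X} {P} (rot d) (rot-adj d) c

  TCol-shift₂ : ∀ {X Y P Q a b} → TCol X P a b → TCol Y Q a b →
                ∀ a' → Σ (Cyc k) λ b' → TCol X P a' b' × TCol Y Q a' b'
  TCol-shift₂ {X} {Y} {P} {Q} {a} {b} c₁ c₂ a' with rot-reaches a a'
  ... | d , refl = rot d b , TCol-map {X} {P} (rot d) (rot-adj d) c₁ , TCol-map {Y} {Q} (rot d) (rot-adj d) c₂

  module _ (X Y : TGraph) where
    private
      module X = TGraph X
      module Y = TGraph Y

    ∥-colouring : (V X.graph → Cyc k) → (V Y.graph → Cyc k) → V (graph (X ∥ Y)) → Cyc k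
    ∥-colouring φ ψ (inj₁ v)       = φ v
    ∥-colouring φ ψ (inj₂ (v , _)) = ψ v

    ∥-colouring-parEmb : ∀ {φ ψ} → ψ Y.s ≡ φ X.s → ψ Y.t ≡ φ X.t →
                         ∀ v → ∥-colouring φ ψ (parEmb X Y v) ≡ ψ v
    ∥-colouring-parEmb ψs≡φs ψt≡φt v with v Y.≟ Y.s | v Y.≟ Y.t
    ... | yes refl | _        = sym ψs≡φs
    ... | no _     | yes refl = sym ψt≡φt
    ... | no _     | no _     = refl

    ∥-glue : ∀ {R a b} → TCol X (R ∘ inj₁) a b → TCol Y (R ∘ inj₂) a b → TCol (X ∥ Y) R a b
    ∥-glue {R} (φ , cφ , φs , φt) (ψ , cψ , ψs , ψt) = ∥-colouring φ ψ , colours , φs , φt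
      where
      agree : ∀ v → ∥-colouring φ ψ (parEmb X Y v) ≡ ψ v
      agree = ∥-colouring-parEmb (trans ψs (sym φs)) (trans ψt (sym φt))
      colours : Colours (graph (X ∥ Y)) R (∥-colouring φ ψ)
      colours (inj₁ e) r = cφ e r
      colours (inj₂ e) r = subst₂ (Adj k) (sym (agree (src Y.graph e))) (sym (agree (tgt Y.graph e))) (cψ e r)

    ∥-restrictˡ : ∀ {R a b} → TCol (X ∥ Y) R a b → TCol X (R ∘ inj₁) a b
    ∥-restrictˡ (φ , c , φs , φt) = φ ∘ inj₁ , (λ e → c (inj₁ e)) , φs , φt

    ∥-restrictʳ : ∀ {R a b} → TCol (X ∥ Y) R a b → TCol Y (R ∘ inj₂) a b
    ∥-restrictʳ (φ , c , φs , φt) = φ ∘ parEmb X Y , (λ e → c (inj₂ e)) ,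
                                    trans (cong φ (parEmb-s X Y)) φs , trans (cong φ (parEmb-t X Y)) φt

    +ₛ-colouring : (V X.graph → Cyc k) → (V Y.graph → Cyc k) → V (graph (X +ₛ Y)) → Cyc k
    +ₛ-colouring φ ψ (inj₁ v)       = φ v
    +ₛ-colouring φ ψ (inj₂ (v , _)) = ψ v

    +ₛ-colouring-serEmb : ∀ {φ ψ} → ψ Y.s ≡ φ X.t → ∀ v → +ₛ-colouring φ ψ (serEmb X Y v) ≡ ψ v
    +ₛ-colouring-serEmb ψs≡φt v with v Y.≟ Y.s
    ... | yes refl = sym ψs≡φt
    ... | no _     = refl

    +ₛ-glue : ∀ {R a b c} → TCol X (R ∘ inj₁) a b → TCol Y (R ∘ inj₂) b c → TCol (X +ₛ Y) R a c
    +ₛ-glue {R} (φ , cφ , φs , φt) (ψ , cψ , ψs , ψt) =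
      +ₛ-colouring φ ψ , colours , φs ,
      trans (cong (+ₛ-colouring φ ψ) (sym (serEmb-t X Y))) (trans (agree Y.t) ψt)
      where
      agree : ∀ v → +ₛ-colouring φ ψ (serEmb X Y v) ≡ ψ v
      agree = +ₛ-colouring-serEmb (trans ψs (sym φt))
      colours : Colours (graph (X +ₛ Y)) R (+ₛ-colouring φ ψ)
      colours (inj₁ e) r = cφ e r
      colours (inj₂ e) r = subst₂ (Adj k) (sym (agree (src Y.graph e))) (sym (agree (tgt Y.graph e))) (cψ e r)

    +ₛ-restrict : ∀ {R a c} → TCol (X +ₛ Y) R a c →
                  Σ (Cyc k) λ b → TCol X (R ∘ inj₁) a b × TCol Y (R ∘ inj₂) b c
    +ₛ-restrict (φ , col , φs , φt) =
      φ (inj₁ X.t) , (φ ∘ inj₁ , (λ e → col (inj₁ e)) , φs , refl) ,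
      (φ ∘ serEmb X Y , (λ e → col (inj₂ e)) , cong φ (serEmb-s X Y) , trans (cong φ (serEmb-t X Y)) φt)

  TCol⇒ColourableOn : ∀ {X P a b} → TCol X P a b → ColourableOn (graph X) P
  TCol⇒ColourableOn (φ , c , _) = φ , c

  ColourableOn⇒TCol : ∀ {X P} (c : ColourableOn (graph X) P) → TCol X P (proj₁ c (s X)) (proj₁ c (t X))
  ColourableOn⇒TCol (φ , c) = φ , c , refl , refl

  adj? : ∀ u v → Dec (Adj k u v)
  adj? u v = (suc (toℕ u) % N ℕ.≟ toℕ v) ⊎-dec (suc (toℕ v) % N ℕ.≟ toℕ u)

  TColourable? : ∀ τ a b → Dec (TColourable ⟦ τ ⟧ a b)
  TColourable? edge a b =
    Dec.map′ (λ ab → (λ { false → a ; true → b }) , (λ _ _ → ab) , refl , refl)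
             (λ { (φ , c , refl , refl) → c tt tt })
             (adj? a b)
  TColourable? (ser α β) a b =
    Dec.map′ (λ (m , c₁ , c₂) → +ₛ-glue ⟦ α ⟧ ⟦ β ⟧ {U} c₁ c₂)
             (+ₛ-restrict ⟦ α ⟧ ⟦ β ⟧ {U})
             (any? λ m → TColourable? α a m ×-dec TColourable? β m b)
  TColourable? (par α β) a b =
    Dec.map′ (λ (c₁ , c₂) → ∥-glue ⟦ α ⟧ ⟦ β ⟧ {U} c₁ c₂)
             (λ c → ∥-restrictˡ ⟦ α ⟧ ⟦ β ⟧ {U} c , ∥-restrictʳ ⟦ α ⟧ ⟦ β ⟧ {U} c)
             (TColourable? α a b ×-dec TColourable? β a b)

  Forcing⇔TColourable : ∀ {S X} → Forcing k S X → ∀ x → x ∈ S ⇔ TColourable X (zeroC k) x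
  Forcing⇔TColourable {X = X} forcing x = TColourable⇔ {X} ⇔-∘ forcing x

  forcingSet : SPTerm → Subset (suc (2 * k))
  forcingSet τ = subset (TColourable? τ (zeroC k))

  ∈-forcingSet⇔ : ∀ τ x → x ∈ forcingSet τ ⇔ TColourable ⟦ τ ⟧ (zeroC k) x
  ∈-forcingSet⇔ τ = ∈-subset⇔ (TColourable? τ (zeroC k))

  forcingSet-forcing : ∀ τ → Forcing k (forcingSet τ) ⟦ τ ⟧
  forcingSet-forcing τ x = ⇔-sym (TColourable⇔ {⟦ τ ⟧}) ⇔-∘ ∈-forcingSet⇔ τ x

  forcingSet-nonempty : ∀ {τ a b} → TColourable ⟦ τ ⟧ a b → Nonempty (forcingSet τ)
  forcingSet-nonempty {τ} c with TCol-shift {⟦ τ ⟧} {U} c (zeroC k)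
  ... | z , c₀ = z , from (∈-forcingSet⇔ τ z) c₀

  forcingSet-symmetric : ∀ τ → Symmetric k (forcingSet τ)
  forcingSet-symmetric τ x x∈S =
    from (∈-forcingSet⇔ τ (neg k x))
      (subst (λ a → TColourable ⟦ τ ⟧ a (neg k x)) neg-zero
        (TCol-map {⟦ τ ⟧} {U} (neg k) neg-adj (to (∈-forcingSet⇔ τ x) x∈S)))

  Incompatible : TGraph → TGraph → Set
  Incompatible X Y = ∀ {a b} → TColourable X a b → TColourable Y a b → ⊥

  Compatible⁻ : TGraph → TGraph → Set
  Compatible⁻ X Y = ∀ e → Σ (Cyc k) λ a → Σ (Cyc k) λ b → TCol X (_≢ e) a b × TColourable Y a b

  DeletionReaches : Subset (suc (2 * k)) → TGraph → Set
  DeletionReaches T X = ∀ e → Σ (Cyc k) λ x → x ∈ T × TCol X (_≢ e) (zeroC k) x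

  forcing-minimal : ∀ {S X} → NoIsolated (graph X) → Forcing k S X →
                    (∀ e → Σ (Cyc k) λ x → x ∉ S × TCol X (_≢ e) (zeroC k) x) → MinForcing k S X
  forcing-minimal {S} {X} ni forcing escapes = forcing , minimal
    where
    minimal : ∀ H' → vs H' (s X) ≡ true → vs H' (t X) ≡ true → Proper H' → ¬ SubForcing k S X H'
    minimal H' _ _ proper subForcing with proper⇒missing-edge H' ni proper
    ... | e , e∉H' with escapes e
    ...   | x , x∉S , c = x∉S (from (subForcing x) (TCol-weaken {X} (kept≢missing H' e∉H') c))

  InF-intro : ∀ {S T X} → SeriesParallel₂ X → Forcing k S X → Empty (S ∩ T) → DeletionReaches T X →
              InF k S T X
  InF-intro {S} {T} {X} sp forcing disjoint reaches =
    sp , forcing-minimal {S} {X} (SeriesParallel₂⇒NoIsolated {X} sp) forcing escapes , reaches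
    where
    escapes : ∀ e → Σ (Cyc k) λ x → x ∉ S × TCol X (_≢ e) (zeroC k) x
    escapes e with reaches e
    ... | x , x∈T , c = x , (λ x∈S → disjoint (x , x∈p∩q⁺ (x∈S , x∈T))) , c

  Incompatible-sym : ∀ {X Y} → Incompatible X Y → Incompatible Y X
  Incompatible-sym incompatible c₁ c₂ = incompatible c₂ c₁

  module _ (α β : SPTerm) where

    forcingSets-disjoint : Incompatible ⟦ α ⟧ ⟦ β ⟧ → Empty (forcingSet α ∩ forcingSet β)
    forcingSets-disjoint incompatible (x , x∈S∩T) with x∈p∩q⁻ (forcingSet α) (forcingSet β) x∈S∩T
    ... | x∈S , x∈T = incompatible (to (∈-forcingSet⇔ α x) x∈S) (to (∈-forcingSet⇔ β x) x∈T)

    forcingSet-deletionReaches : Compatible⁻ ⟦ α ⟧ ⟦ β ⟧ → DeletionReaches (forcingSet β) ⟦ α ⟧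
    forcingSet-deletionReaches compatible⁻ e with compatible⁻ e
    ... | _ , _ , c₁ , c₂ with TCol-shift₂ {⟦ α ⟧} {⟦ β ⟧} {_≢ e} {U} c₁ c₂ (zeroC k)
    ...   | z , c₁' , c₂' = z , from (∈-forcingSet⇔ β z) c₂' , c₁'

  module _ (X Y : TGraph) where

    ∥-uncolourable⇒Incompatible : ¬ Colourable k (graph (X ∥ Y)) → Incompatible X Y
    ∥-uncolourable⇒Incompatible uncolourable c₁ c₂ =
      uncolourable (TColourable⇒Colourable {X ∥ Y} (∥-glue X Y {U} c₁ c₂))

    ∥-EdgeDeletionsColourable⇒Compatible⁻ˡ : EdgeDeletionsColourable (graph (X ∥ Y)) → Compatible⁻ X Y
    ∥-EdgeDeletionsColourable⇒Compatible⁻ˡ deletionsColourable e =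
      _ , _ , TCol-weaken {X} (λ e'≢e → e'≢e ∘ inj₁-injective) (∥-restrictˡ X Y c) ,
              TCol-weaken {Y} (λ _ ()) (∥-restrictʳ X Y c)
      where
      c : TCol (X ∥ Y) (_≢ inj₁ e) _ _
      c = ColourableOn⇒TCol {X ∥ Y} (deletionsColourable (inj₁ e))

    ∥-EdgeDeletionsColourable⇒Compatible⁻ʳ : EdgeDeletionsColourable (graph (X ∥ Y)) → Compatible⁻ Y X
    ∥-EdgeDeletionsColourable⇒Compatible⁻ʳ deletionsColourable e =
      _ , _ , TCol-weaken {Y} (λ e'≢e → e'≢e ∘ inj₂-injective) (∥-restrictʳ X Y c) ,
              TCol-weaken {X} (λ _ ()) (∥-restrictˡ X Y c)
      where
      c : TCol (X ∥ Y) (_≢ inj₂ e) _ _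
      c = ColourableOn⇒TCol {X ∥ Y} (deletionsColourable (inj₂ e))

    +ₛ-colourable : E (graph X) → E (graph Y) → EdgeDeletionsColourable (graph (X +ₛ Y)) →
                    Colourable k (graph (X +ₛ Y))
    +ₛ-colourable eX eY deletionsColourable
      with +ₛ-restrict X Y (ColourableOn⇒TCol {X +ₛ Y} (deletionsColourable (inj₂ eY)))
         | +ₛ-restrict X Y (ColourableOn⇒TCol {X +ₛ Y} (deletionsColourable (inj₁ eX)))
    ... | b , cX , _ | _ , _ , cY with TCol-shift {Y} (TCol-weaken {Y} (λ _ ()) cY) b
    ...   | _ , cY' = TColourable⇒Colourable {X +ₛ Y} (+ₛ-glue X Y {U} (TCol-weaken {X} (λ _ ()) cX) cY')

    ∥-uncolourable : ∀ {S T} → Forcing k S X → Forcing k T Y → Empty (S ∩ T) →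
                     ¬ Colourable k (graph (X ∥ Y))
    ∥-uncolourable forcingX forcingY disjoint c =
      let c' = Colourable⇒TColourable {X ∥ Y} c
          z , cX , cY = TCol-shift₂ {X} {Y} (∥-restrictˡ X Y c') (∥-restrictʳ X Y c') (zeroC k)
      in disjoint (z , x∈p∩q⁺ (from (Forcing⇔TColourable {X = X} forcingX z) cX ,
                               from (Forcing⇔TColourable {X = Y} forcingY z) cY))

    ∥-EdgeDeletionsColourable : ∀ {S T A B} → Forcing k S X → Forcing k T Y →
                                DeletionReaches A X → DeletionReaches B Y → A ⊆ T → B ⊆ S →
                                EdgeDeletionsColourable (graph (X ∥ Y))
    ∥-EdgeDeletionsColourable _ forcingY reachesX _ A⊆T _ (inj₁ e) with reachesX e
    ... | x , x∈A , cX = TCol⇒ColourableOn {X ∥ Y} (∥-glue X Y {_≢ inj₁ e}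
      (TCol-weaken {X} {P = _≢ e} (λ x≢e → x≢e ∘ cong inj₁) cX)
      (TCol-weaken {Y} (λ _ → tt) (to (Forcing⇔TColourable {X = Y} forcingY x) (A⊆T x∈A))))
    ∥-EdgeDeletionsColourable forcingX _ _ reachesY _ B⊆S (inj₂ e) with reachesY e
    ... | x , x∈B , cY = TCol⇒ColourableOn {X ∥ Y} (∥-glue X Y {_≢ inj₂ e}
      (TCol-weaken {X} (λ _ → tt) (to (Forcing⇔TColourable {X = X} forcingX x) (B⊆S x∈B)))
      (TCol-weaken {Y} {P = _≢ e} (λ x≢e → x≢e ∘ cong inj₂) cY))

  critical-≅⇒EdgeCritical : ∀ {G} τ → G ≅ graph ⟦ τ ⟧ → Critical k G → EdgeCritical (graph ⟦ τ ⟧)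
  critical-≅⇒EdgeCritical τ i critical =
    proj₁ critical ∘ Colourable-pullback i ,
    EdgeDeletionsColourable-pullback (≅-sym i)
      (critical⇒EdgeDeletionsColourable critical (via-injection (↔⇒↣ (emap i)) (_≟ᴱ_ {τ})))

  edgeT-colourable : Colourable k (graph edgeT)
  edgeT-colourable = (λ { false → zeroC k ; true → σ (zeroC k) }) , λ _ → adj-σ (zeroC k)

  EdgeCritical⇒parallel : ∀ τ → EdgeCritical (graph ⟦ τ ⟧) →
                          Σ SPTerm λ α → Σ SPTerm λ β → τ ≡ par α β
  EdgeCritical⇒parallel edge (uncolourable , _) = ⊥-elim (uncolourable edgeT-colourable)
  EdgeCritical⇒parallel (ser α β) (uncolourable , deletionsColourable) =
    ⊥-elim (uncolourable (+ₛ-colourable ⟦ α ⟧ ⟦ β ⟧ (some-edge α) (some-edge β) deletionsColourable))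
  EdgeCritical⇒parallel (par α β) _ = α , β , refl

  ParallelDecomposition : Graph → Set₁
  ParallelDecomposition G =
    Σ (Subset (suc (2 * k))) λ S → Σ (Subset (suc (2 * k))) λ T →
    Σ (Subset (suc (2 * k))) λ A → Σ (Subset (suc (2 * k))) λ B →
      Nonempty S × Nonempty T × Nonempty A × Nonempty B ×
      Symmetric k S × Symmetric k T × Symmetric k A × Symmetric k B ×
      Empty (S ∩ T) × A ⊆ T × B ⊆ S ×
      (Σ TGraph λ G₁ → Σ TGraph λ G₂ →
         InF k S A G₁ × InF k T B G₂ × (G ≅ graph (G₁ ∥ G₂)))

  EdgeCritical-∥⇒ParallelDecomposition : ∀ {G} α β → G ≅ graph (⟦ α ⟧ ∥ ⟦ β ⟧) →
                                         EdgeCritical (graph (⟦ α ⟧ ∥ ⟦ β ⟧)) → ParallelDecomposition G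
  EdgeCritical-∥⇒ParallelDecomposition α β i (uncolourable , deletionsColourable) =
    forcingSet α , forcingSet β , forcingSet β , forcingSet α ,
    S-nonempty , T-nonempty , T-nonempty , S-nonempty ,
    forcingSet-symmetric α , forcingSet-symmetric β , forcingSet-symmetric β , forcingSet-symmetric α ,
    S∩T-empty , id , id ,
    ⟦ α ⟧ , ⟦ β ⟧ ,
    InF-intro (α , ≅₂-refl ⟦ α ⟧) (forcingSet-forcing α) S∩T-empty
              (forcingSet-deletionReaches α β compatibleˡ) ,
    InF-intro (β , ≅₂-refl ⟦ β ⟧) (forcingSet-forcing β)
              (forcingSets-disjoint β α (Incompatible-sym {⟦ α ⟧} {⟦ β ⟧} incompatible))
              (forcingSet-deletionReaches β α compatibleʳ) ,
    i
    where
    incompatible : Incompatible ⟦ α ⟧ ⟦ β ⟧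
    incompatible = ∥-uncolourable⇒Incompatible ⟦ α ⟧ ⟦ β ⟧ uncolourable

    compatibleˡ : Compatible⁻ ⟦ α ⟧ ⟦ β ⟧
    compatibleˡ = ∥-EdgeDeletionsColourable⇒Compatible⁻ˡ ⟦ α ⟧ ⟦ β ⟧ deletionsColourable

    compatibleʳ : Compatible⁻ ⟦ β ⟧ ⟦ α ⟧
    compatibleʳ = ∥-EdgeDeletionsColourable⇒Compatible⁻ʳ ⟦ α ⟧ ⟦ β ⟧ deletionsColourable

    S∩T-empty : Empty (forcingSet α ∩ forcingSet β)
    S∩T-empty = forcingSets-disjoint α β incompatible

    S-nonempty : Nonempty (forcingSet α)
    S-nonempty = let _ , _ , _ , c = compatibleʳ (some-edge β) in forcingSet-nonempty {α} c

    T-nonempty : Nonempty (forcingSet β)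
    T-nonempty = let _ , _ , _ , c = compatibleˡ (some-edge α) in forcingSet-nonempty {β} c

  critical⇒ParallelDecomposition : ∀ {G} τ → G ≅ graph ⟦ τ ⟧ → Critical k G → ParallelDecomposition G
  critical⇒ParallelDecomposition τ i critical with critical-≅⇒EdgeCritical τ i critical
  ... | edgeCritical with EdgeCritical⇒parallel τ edgeCritical
  ...   | α , β , refl = EdgeCritical-∥⇒ParallelDecomposition α β i edgeCritical

  ParallelDecomposition⇒critical : ∀ {G} → ParallelDecomposition G → Critical k G
  ParallelDecomposition⇒critical
    (_ , _ , _ , _ , _ , _ , _ , _ , _ , _ , _ , _ , S∩T-empty , A⊆T , B⊆S , G₁ , G₂ ,
     (sp₁ , (forcing₁ , _) , reaches₁) , (sp₂ , (forcing₂ , _) , reaches₂) , j) =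
    ∥-uncolourable G₁ G₂ forcing₁ forcing₂ S∩T-empty ∘ Colourable-pullback (≅-sym j) ,
    EdgeDeletionsColourable⇒subColourable noIsolated
      (EdgeDeletionsColourable-pullback j
        (∥-EdgeDeletionsColourable G₁ G₂ forcing₁ forcing₂ reaches₁ reaches₂ A⊆T B⊆S))
    where
    noIsolated : NoIsolated _
    noIsolated = NoIsolated-≅ (≅-sym j)
      (NoIsolated-∥ G₁ G₂ (SeriesParallel₂⇒NoIsolated sp₁) (SeriesParallel₂⇒NoIsolated sp₂))

theorem4p2 : (k : ℕ) → 2 ≤ k → (G : Graph) → SeriesParallel G →
    Critical k G ⇔
    (Σ (Subset (suc (2 * k))) λ S → Σ (Subset (suc (2 * k))) λ T →
     Σ (Subset (suc (2 * k))) λ A → Σ (Subset (suc (2 * k))) λ B →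
       Nonempty S × Nonempty T × Nonempty A × Nonempty B ×
       Symmetric k S × Symmetric k T × Symmetric k A × Symmetric k B ×
       Empty (S ∩ T) × A ⊆ T × B ⊆ S ×
       (Σ TGraph λ G₁ → Σ TGraph λ G₂ →
          InF k S A G₁ × InF k T B G₂ × (G ≅ graph (G₁ ∥ G₂))))
-- The argument works for every k.
theorem4p2 k _ G (_ , _ , τ , i , _) =
  mk⇔ (critical⇒ParallelDecomposition τ i) ParallelDecomposition⇒critical
  where open Colourings k
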